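{- Consider the distributed schema with two sources: source 1 with binary relations $R$ and $S_1$, source 2 with binary relations $T$ and $S_2$, and background knowledge $\Sigma=\{\forall x,y\,(S_1(x,y)\leftrightarrow S_2(x,y))\}$ (so $S$ is replicated; write $S$ for the common relation). Let $Q=\exists x,y\,(R(x,y)\wedge S(x,y)\wedge T(x,y))$ and $P=\exists x\,R(x,x)$. Then there is no d-view consisting of monotone views that is useful for $Q$ and UN non-disclosing for $P$ relative to $\Sigma$.
   Context: A d-view assigns to each source finitely many views, each a function of instances of that source's relations. A view $V$ is monotone if whenever instance $I_1$ is a subinstance of $I_2$ (every relation of $I_1$ is contained in the corresponding relation of $I_2$), $V(I_1)\subseteq V(I_2)$. Relative to $\Sigma$: $\mathcal{V}$ determines a Boolean query at a d-instance $\mathcal{D}$ satisfying $\Sigma$ if every d-instance satisfying $\Sigma$ on which all views agree with $\mathcal{D}$ gives the same answer; useful for $Q$: determines $Q$ at every d-instance satisfying $\Sigma$; UN non-disclosing for $P$: does not determine $P$ at any d-instance satisfying $\Sigma$ and $P$. Instances may be finite or infinite. -}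

module Defs where

open import Data.Nat using (ℕ)
open import Data.Fin using (Fin)
open import Data.Product using (Σ; _×_; ∃; _,_)
open import Relation.Nullary using (¬_)

_⇔_ : Set → Set → Set
A ⇔ B = (A → B) × (B → A)

-- Domain of constants: ℕ (a fixed countably infinite domain).
-- Relations are arbitrary (possibly infinite) predicates.
Rel₂ : Set₁
Rel₂ = ℕ → ℕ → Set

record Inst₁ : Set₁ where
  field
    R  : Rel₂
    S₁ : Rel₂

record Inst₂ : Set₁ where
  field
    T  : Rel₂
    S₂ : Rel₂

_⊑₁_ : Inst₁ → Inst₁ → Set
I ⊑₁ J = (∀ x y → Inst₁.R I x y → Inst₁.R J x y)
       × (∀ x y → Inst₁.S₁ I x y → Inst₁.S₁ J x y)

_⊑₂_ : Inst₂ → Inst₂ → Set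
I ⊑₂ J = (∀ x y → Inst₂.T I x y → Inst₂.T J x y)
       × (∀ x y → Inst₂.S₂ I x y → Inst₂.S₂ J x y)

record DInst : Set₁ where
  constructor dinst
  field
    src₁ : Inst₁
    src₂ : Inst₂

SatΣ : DInst → Set
SatΣ D = ∀ x y → Inst₁.S₁ (DInst.src₁ D) x y ⇔ Inst₂.S₂ (DInst.src₂ D) x y

-- Q = ∃x,y (R(x,y) ∧ S(x,y) ∧ T(x,y)), with S read as S₁ (= S₂ under Σ).
Q : DInst → Set
Q D = Σ ℕ λ x → Σ ℕ λ y →
        Inst₁.R (DInst.src₁ D) x y × Inst₁.S₁ (DInst.src₁ D) x y × Inst₂.T (DInst.src₂ D) x y

P : DInst → Set
P D = Σ ℕ λ x → Inst₁.R (DInst.src₁ D) x x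

record View (I : Set₁) : Set₁ where
  field
    Out : Set
    app : I → Out → Set

Monotone : {I : Set₁} → (I → I → Set) → View I → Set₁
Monotone {I} _⊑_ V = ∀ (I₁ I₂ : I) → I₁ ⊑ I₂ → ∀ o → View.app V I₁ o → View.app V I₂ o

record DView : Set₁ where
  field
    n₁ : ℕ
    v₁ : Fin n₁ → View Inst₁
    n₂ : ℕ
    v₂ : Fin n₂ → View Inst₂

AllMonotone : DView → Set₁
AllMonotone 𝒱 = (∀ i → Monotone _⊑₁_ (DView.v₁ 𝒱 i))
              × (∀ j → Monotone _⊑₂_ (DView.v₂ 𝒱 j))

Agree : DView → DInst → DInst → Set
Agree 𝒱 D D' =
    (∀ i o → View.app (DView.v₁ 𝒱 i) (DInst.src₁ D) o ⇔ View.app (DView.v₁ 𝒱 i) (DInst.src₁ D') o)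
  × (∀ j o → View.app (DView.v₂ 𝒱 j) (DInst.src₂ D) o ⇔ View.app (DView.v₂ 𝒱 j) (DInst.src₂ D') o)

Determines : DView → (DInst → Set) → DInst → Set₁
Determines 𝒱 Φ D = ∀ D' → SatΣ D' → Agree 𝒱 D D' → Φ D ⇔ Φ D'

Useful : DView → (DInst → Set) → Set₁
Useful 𝒱 Φ = ∀ D → SatΣ D → Determines 𝒱 Φ D

UNNonDisclosing : DView → (DInst → Set) → Set₁
UNNonDisclosing 𝒱 Φ = ∀ D → SatΣ D → Φ D → ¬ Determines 𝒱 Φ D

module Submission where

-- Let ⊤ be the d-instance in which every relation is total.
-- It satisfies Σ and P, so UN non-disclosure says the views do not determine
-- P at ⊤; we derive a contradiction by showing that they do.
--
-- Take D' ⊨ Σ agreeing with ⊤ on all views and let X be source 1 of D' with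
-- S₁ made total.  Then src₁ D' ⊑ X ⊑ ⊤₁, and since the source-1 views agree
-- on the two ends of this chain, monotonicity squeezes them to agree on X too
-- ("sandwich" lemma).  Now pair both ⊤₁ and X with the source-2 instance
-- whose T is the diagonal and whose S₂ is total: both d-instances satisfy Σ,
-- agree on all views, and Q holds on the first (at (0,0)).  Usefulness for Q
-- transfers Q to the second, which forces R of D' to contain some (x,x),
-- i.e. P holds on D'.  Hence P is determined at ⊤.

open import Defs
open import Data.Empty using (⊥)
open import Data.Unit using (⊤; tt)
open import Data.Product using (_,_; proj₁)
open import Relation.Binary.PropositionalEquality using (_≡_; refl)

sandwich : {I : Set₁} {_⊑_ : I → I → Set} (V : View I) → Monotone _⊑_ V →
           {I₁ I₂ I₃ : I} → I₁ ⊑ I₂ → I₂ ⊑ I₃ →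
           (∀ o → View.app V I₃ o → View.app V I₁ o) →
           ∀ o → View.app V I₂ o ⇔ View.app V I₃ o
sandwich V mon {I₁} {I₂} {I₃} 1⊑2 2⊑3 back o =
  (λ v → mon I₂ I₃ 2⊑3 o v) , (λ v → mon I₁ I₂ 1⊑2 o (back o v))

agreeOnSource₁ : (𝒱 : DView) (I J : Inst₁) (K : Inst₂) →
                 (∀ i o → View.app (DView.v₁ 𝒱 i) I o ⇔ View.app (DView.v₁ 𝒱 i) J o) →
                 Agree 𝒱 (dinst I K) (dinst J K)
agreeOnSource₁ 𝒱 I J K ag₁ = ag₁ , λ j o → (λ v → v) , (λ v → v)

total : Rel₂
total _ _ = ⊤

diagonal : Rel₂
diagonal x y = x ≡ y

total₁ : Inst₁
total₁ = record { R = total ; S₁ = total }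

withTotalS₁ : Inst₁ → Inst₁
withTotalS₁ I = record { R = Inst₁.R I ; S₁ = total }

diagonal₂ : Inst₂
diagonal₂ = record { T = diagonal ; S₂ = total }

totalD : DInst
totalD = dinst total₁ (record { T = total ; S₂ = total })

satΣ-totalS : (I : Inst₁) (K : Inst₂) → Inst₁.S₁ I ≡ total → Inst₂.S₂ K ≡ total →
              SatΣ (dinst I K)
satΣ-totalS I K refl refl _ _ = (λ _ → tt) , (λ _ → tt)

-- Usefulness for Q detects reflexive R-tuples: if the source-1 views cannot
-- tell I (with total S₁) apart from total₁, then R of I has a loop, since
-- paired with diagonal₂ the instance total₁ satisfies Q at (0,0).
useful⇒loop : (𝒱 : DView) → Useful 𝒱 Q → (I : Inst₁) → Inst₁.S₁ I ≡ total →
              (∀ i o → View.app (DView.v₁ 𝒱 i) total₁ o ⇔ View.app (DView.v₁ 𝒱 i) I o) →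
              P (dinst I diagonal₂)
useful⇒loop 𝒱 useful I S₁-total ag₁ with Q-on-I
  where
  Q-on-I : Q (dinst I diagonal₂)
  Q-on-I = proj₁ (useful (dinst total₁ diagonal₂) (satΣ-totalS total₁ diagonal₂ refl refl)
                         (dinst I diagonal₂) (satΣ-totalS I diagonal₂ S₁-total refl)
                         (agreeOnSource₁ 𝒱 total₁ I diagonal₂ ag₁))
                 (0 , 0 , tt , tt , refl)
... | x , .x , r , _ , refl = x , r

P-determined-at-total : (𝒱 : DView) → AllMonotone 𝒱 → Useful 𝒱 Q → Determines 𝒱 P totalD
P-determined-at-total 𝒱 (mon₁ , _) useful D' _ (ag₁ , _) =
  (λ _ → useful⇒loop 𝒱 useful X refl X-agrees) , (λ _ → 0 , tt)
  where
  X : Inst₁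
  X = withTotalS₁ (DInst.src₁ D')

  D'⊑X : DInst.src₁ D' ⊑₁ X
  D'⊑X = (λ _ _ r → r) , (λ _ _ _ → tt)

  X⊑total : X ⊑₁ total₁
  X⊑total = (λ _ _ _ → tt) , (λ _ _ _ → tt)

  X-agrees : ∀ i o → View.app (DView.v₁ 𝒱 i) total₁ o ⇔ View.app (DView.v₁ 𝒱 i) X o
  X-agrees i o =
    let (X→total , total→X) = sandwich (DView.v₁ 𝒱 i) (mon₁ i) D'⊑X X⊑total
                                       (λ o → proj₁ (ag₁ i o)) o
    in total→X , X→total

mainTheorem14 : (𝒱 : DView) → AllMonotone 𝒱 → Useful 𝒱 Q → UNNonDisclosing 𝒱 P → ⊥
mainTheorem14 𝒱 monotone useful nonDisclosing =
  nonDisclosing totalD (satΣ-totalS total₁ (DInst.src₂ totalD) refl refl) (0 , tt)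
                (P-determined-at-total 𝒱 monotone useful)
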